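{- Let $m\geq 2$, $n_1,\ldots,n_m\geq 2$ integers and $\sigma\in Sym(m)$. Then $$(P^{\sigma}_{n_1,\ldots,n_m})^{ -1}=(P^{\sigma}_{n_1,\ldots,n_m})^{T}=P^{\sigma^{ -1}}_{n_{\sigma^{ -1}(1)},n_{\sigma^{ -1}(2)},\ldots,n_{\sigma^{ -1}(m)}}.$$
   Context: For positive integers $a,b$ and $1\le i\le a$, $1\le j\le b$, $E^{i,j}_{a\times b}$ denotes the $a\times b$ real matrix with entry $1$ in row $i$, column $j$ and $0$ elsewhere; $\otimes$ is the Kronecker product. For integers $k_1,\ldots,k_m\ge 2$ and $\rho\in Sym(m)$, the shuffling matrix is the $(k_1\cdots k_m)\times(k_1\cdots k_m)$ permutation matrix $$P^{\rho}_{k_1,\ldots,k_m}=\sum_{\substack{i_j=1,\ldots,k_j\\ j=1,\ldots,m}} E^{i_{\rho^{ -1}(1)},i_1}_{k_{\rho^{ -1}(1)}\times k_1}\otimes\cdots\otimes E^{i_{\rho^{ -1}(m)},i_m}_{k_{\rho^{ -1}(m)}\times k_m}.$$ -}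

module Defs where

open import Data.Nat using (ℕ; zero; suc; _+_; _*_)
open import Data.Fin using (Fin; zero; suc; remQuot; cast; _≟_)
open import Data.Fin.Permutation using (Permutation′; _⟨$⟩ʳ_; _⟨$⟩ˡ_)
open import Data.List using (List; []; _∷_; map; concatMap; allFin)
open import Data.Nat.ListAction using (sum)
open import Data.Product using (Σ; _×_; _,_)
open import Data.Bool using (if_then_else_; _∧_)
open import Relation.Nullary using (does)
open import Relation.Binary.PropositionalEquality using (_≡_)

-- Matrices with a rows and b columns (entries in ℕ; all matrices here are 0/1).
Mat : ℕ → ℕ → Set
Mat a b = Fin a → Fin b → ℕ

E : (a b : ℕ) → Fin a → Fin b → Mat a b
E a b i j r c = if does (r ≟ i) ∧ does (c ≟ j) then 1 else 0

transpose : ∀ {a b} → Mat a b → Mat b a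
transpose A i j = A j i

∑ : (n : ℕ) → (Fin n → ℕ) → ℕ
∑ n f = sum (map f (allFin n))

infixl 7 _·_
_·_ : ∀ {a b c} → Mat a b → Mat b c → Mat a c
_·_ {b = b} A B i k = ∑ b (λ j → A i j * B j k)

idMat : (n : ℕ) → Mat n n
idMat n i j = if does (i ≟ j) then 1 else 0

-- Kronecker product (row index (i-1)·p + k, as usual)
_⊗_ : ∀ {a b p q} → Mat a b → Mat p q → Mat (a * p) (b * q)
_⊗_ {p = p} {q = q} A B r c with remQuot p r | remQuot q c
... | i , k | j , l = A i j * B k l

prod : (m : ℕ) → (Fin m → ℕ) → ℕ
prod zero ks = 1
prod (suc m) ks = ks zero * prod m (λ j → ks (suc j))

kron : (m : ℕ) (a b : Fin m → ℕ) → ((j : Fin m) → Mat (a j) (b j)) → Mat (prod m a) (prod m b)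
kron zero a b M r c = 1
kron (suc m) a b M = M zero ⊗ kron m (λ j → a (suc j)) (λ j → b (suc j)) (λ j → M (suc j))

Tuple : (m : ℕ) → (Fin m → ℕ) → Set
Tuple m ks = (j : Fin m) → Fin (ks j)

consT : ∀ {m} {ks : Fin (suc m) → ℕ} → Fin (ks zero) → Tuple m (λ j → ks (suc j)) → Tuple (suc m) ks
consT i t zero = i
consT i t (suc j) = t j

tuples : (m : ℕ) (ks : Fin m → ℕ) → List (Tuple m ks)
tuples zero ks = (λ ()) ∷ []
tuples (suc m) ks = concatMap (λ i → map (consT {ks = ks} i) (tuples m (λ j → ks (suc j)))) (allFin (ks zero))

sumT : ∀ {a b} (m : ℕ) (ks : Fin m → ℕ) → (Tuple m ks → Mat a b) → Mat a b
sumT m ks F r c = sum (map (λ t → F t r c) (tuples m ks))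

-- Shuffling matrix P^ρ_{k_1,…,k_m}; ρ⁻¹(j) is  ρ ⟨$⟩ˡ j.
-- It is a (k_{ρ⁻¹(1)}⋯k_{ρ⁻¹(m)}) × (k_1⋯k_m) matrix (these numbers are equal).
shuffle : (m : ℕ) (ks : Fin m → ℕ) (ρ : Permutation′ m) →
          Mat (prod m (λ j → ks (ρ ⟨$⟩ˡ j))) (prod m ks)
shuffle m ks ρ = sumT m ks (λ t →
  kron m (λ j → ks (ρ ⟨$⟩ˡ j)) ks (λ j → E (ks (ρ ⟨$⟩ˡ j)) (ks j) (t (ρ ⟨$⟩ˡ j)) (t j)))

-- Equality of matrices whose (propositionally equal) dimensions are stated separately.
_≋_ : ∀ {a b c d} → Mat a b → Mat c d → Set
_≋_ {a} {b} {c} {d} A B =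
  Σ (a ≡ c) λ p → Σ (b ≡ d) λ q → ∀ i j → A i j ≡ B (cast p i) (cast q j)

-- Equality of matrices of the same dimensions (entrywise; no funext in Agda).
infix 4 _≐_ _≋_
_≐_ : ∀ {a b} → Mat a b → Mat a b → Set
A ≐ B = ∀ i j → A i j ≡ B i j

-- Each summand of P^ρ is a Kronecker product of matrix units, so entry (r, c) of the sum is 1
-- exactly when the mixed-radix digits of r are those of c permuted by ρ⁻¹, and 0 otherwise.
-- Hence P^ρ is the permutation matrix of a bijection of indices, so it is orthogonal, and its
-- transpose is the permutation matrix of the inverse bijection, which permutes the digits by ρ:
-- that is P^{ρ⁻¹} for the permuted sizes n_{σ⁻¹(1)}, …, n_{σ⁻¹(m)}.
module Submission where

open import Defs
open import Data.Nat using (ℕ; _≤_; zero; suc; _+_; _*_)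
open import Data.Nat.Properties
  using (*-comm; *-assoc; *-distribʳ-+; *-zeroʳ; *-identityʳ; +-identityʳ; [m*n]*[o*p]≡[m*o]*[n*p])
open import Data.Fin using (Fin; zero; suc; toℕ; cast; combine; quotient; remainder; _≟_)
open import Data.Fin.Properties
  using (toℕ-injective; toℕ-cast; toℕ-combine; cast-is-id; remQuot-combine; combine-remQuot;
         combine-injectiveˡ; combine-injectiveʳ)
open import Data.Fin.Permutation
  using (Permutation; Permutation′; permutation; _⟨$⟩ʳ_; _⟨$⟩ˡ_; flip; inverseˡ; inverseʳ)
open import Data.List using (List; []; _∷_; _++_; map; concatMap; allFin; tabulate)
open import Data.List.Properties using (map-cong; map-∘; map-++; map-tabulate)
open import Data.Nat.ListAction using (sum)
open import Data.Nat.ListAction.Properties using (sum-++)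
open import Data.Product using (_×_; _,_; proj₁; proj₂)
open import Function using (_∘_; _⇔_; mk⇔; Equivalence)
open import Relation.Nullary using (yes; no; contradiction)
open import Relation.Binary.PropositionalEquality
open ≡-Reasoning

private
  variable
    a b m n : ℕ

δ : Fin n → Fin n → ℕ
δ {n} = idMat n

δ-cong-⇔ : {x y : Fin a} {x′ y′ : Fin b} → (x ≡ y ⇔ x′ ≡ y′) → δ x y ≡ δ x′ y′
δ-cong-⇔ {x = x} {y} {x′} {y′} x≡y⇔x′≡y′ with x ≟ y | x′ ≟ y′
... | yes _   | yes _    = refl
... | no _    | no _     = refl
... | yes x≡y | no x′≢y′ = contradiction (Equivalence.to x≡y⇔x′≡y′ x≡y) x′≢y′
... | no x≢y  | yes x′≡y′ = contradiction (Equivalence.from x≡y⇔x′≡y′ x′≡y′) x≢y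

δ-sym : (x y : Fin n) → δ x y ≡ δ y x
δ-sym x y = δ-cong-⇔ {x = x} {y} {y} {x} (mk⇔ sym sym)

δ-refl : (x : Fin n) → δ x x ≡ 1
δ-refl x with x ≟ x
... | yes _   = refl
... | no x≢x = contradiction refl x≢x

δ-≢ : {x y : Fin n} → x ≢ y → δ x y ≡ 0
δ-≢ {x = x} {y} x≢y with x ≟ y
... | yes x≡y = contradiction x≡y x≢y
... | no _    = refl

δ-toℕ : {x y : Fin a} {x′ y′ : Fin b} → toℕ x ≡ toℕ x′ → toℕ y ≡ toℕ y′ → δ x y ≡ δ x′ y′
δ-toℕ x≈x′ y≈y′ = δ-cong-⇔ (mk⇔
  (λ x≡y → toℕ-injective (trans (sym x≈x′) (trans (cong toℕ x≡y) y≈y′)))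
  (λ x′≡y′ → toℕ-injective (trans x≈x′ (trans (cong toℕ x′≡y′) (sym y≈y′)))))

δ-combine : (x z : Fin a) (y w : Fin b) → δ (combine x y) (combine z w) ≡ δ x z * δ y w
δ-combine x z y w with x ≟ z | y ≟ w
... | yes refl | yes refl = δ-refl (combine x y)
... | yes refl | no y≢w   = δ-≢ (y≢w ∘ combine-injectiveʳ x y x w)
... | no x≢z   | _        = δ-≢ (x≢z ∘ combine-injectiveˡ x y z w)

E≡δ*δ : (i : Fin a) (j : Fin b) (r : Fin a) (c : Fin b) → E a b i j r c ≡ δ r i * δ c j
E≡δ*δ i j r c with r ≟ i | c ≟ j
... | yes _ | yes _ = refl
... | yes _ | no _  = refl
... | no _  | _     = refl

∑-cong : {f g : Fin n → ℕ} → (∀ j → f j ≡ g j) → ∑ n f ≡ ∑ n g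
∑-cong {n} f≗g = cong sum (map-cong f≗g (allFin n))

∑-suc : (f : Fin (suc n) → ℕ) → ∑ (suc n) f ≡ f zero + ∑ n (f ∘ suc)
∑-suc {n} f = cong (f zero +_) (cong sum (begin
  map f (tabulate suc)     ≡⟨ map-tabulate suc f ⟩
  tabulate (f ∘ suc)       ≡⟨ map-tabulate (λ j → j) (f ∘ suc) ⟨
  map (f ∘ suc) (allFin n) ∎))

∑-zero : {f : Fin n → ℕ} → (∀ j → f j ≡ 0) → ∑ n f ≡ 0
∑-zero {zero}  f≡0 = refl
∑-zero {suc n} {f} f≡0 = trans (∑-suc f) (cong₂ _+_ (f≡0 zero) (∑-zero (f≡0 ∘ suc)))

∑-select : (f : Fin n → ℕ) (x : Fin n) → ∑ n (λ j → f j * δ x j) ≡ f x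
∑-select {suc n} f zero = begin
  ∑ (suc n) (λ j → f j * δ zero j)  ≡⟨ ∑-suc (λ j → f j * δ zero j) ⟩
  f zero * 1 + ∑ n (λ j → f (suc j) * 0)  ≡⟨ cong₂ _+_ (*-identityʳ (f zero)) (∑-zero (λ j → *-zeroʳ (f (suc j)))) ⟩
  f zero + 0  ≡⟨ +-identityʳ (f zero) ⟩
  f zero      ∎
∑-select {suc n} f (suc x) = begin
  ∑ (suc n) (λ j → f j * δ (suc x) j)  ≡⟨ ∑-suc (λ j → f j * δ (suc x) j) ⟩
  f zero * 0 + ∑ n (λ j → f (suc j) * δ x j)  ≡⟨ cong (_+ ∑ n (λ j → f (suc j) * δ x j)) (*-zeroʳ (f zero)) ⟩
  ∑ n (λ j → f (suc j) * δ x j)  ≡⟨ ∑-select (f ∘ suc) x ⟩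
  f (suc x)  ∎

sum-map-*ʳ : {A : Set} (f : A → ℕ) (c : ℕ) (xs : List A) →
             sum (map (λ x → f x * c) xs) ≡ sum (map f xs) * c
sum-map-*ʳ f c []       = refl
sum-map-*ʳ f c (x ∷ xs) = trans (cong (f x * c +_) (sum-map-*ʳ f c xs)) (sym (*-distribʳ-+ c (f x) _))

sum-map-concatMap : {A B : Set} (f : B → ℕ) (g : A → List B) (xs : List A) →
                    sum (map f (concatMap g xs)) ≡ sum (map (λ x → sum (map f (g x))) xs)
sum-map-concatMap f g []       = refl
sum-map-concatMap f g (x ∷ xs) = begin
  sum (map f (g x ++ concatMap g xs))               ≡⟨ cong sum (map-++ f (g x) _) ⟩
  sum (map f (g x) ++ map f (concatMap g xs))       ≡⟨ sum-++ (map f (g x)) _ ⟩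
  sum (map f (g x)) + sum (map f (concatMap g xs))  ≡⟨ cong (sum (map f (g x)) +_) (sum-map-concatMap f g xs) ⟩
  sum (map (λ x → sum (map f (g x))) (x ∷ xs))      ∎

∑ₜ : (m : ℕ) (ks : Fin m → ℕ) → (Tuple m ks → ℕ) → ℕ
∑ₜ m ks f = sum (map f (tuples m ks))

∑ₜ-cong : {ks : Fin m → ℕ} {f g : Tuple m ks → ℕ} → (∀ t → f t ≡ g t) → ∑ₜ m ks f ≡ ∑ₜ m ks g
∑ₜ-cong {m} {ks} f≗g = cong sum (map-cong f≗g (tuples m ks))

∑ₜ-suc : (ks : Fin (suc m) → ℕ) (f : Tuple (suc m) ks → ℕ) →
         ∑ₜ (suc m) ks f ≡ ∑ (ks zero) (λ i → ∑ₜ m (ks ∘ suc) (f ∘ consT i))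
∑ₜ-suc {m} ks f = trans (sum-map-concatMap f _ (allFin (ks zero)))
  (∑-cong (λ i → cong sum (sym (map-∘ {g = f} {f = consT i} (tuples m (ks ∘ suc))))))

δₜ : {ks : Fin m → ℕ} → Tuple m ks → Tuple m ks → ℕ
δₜ {m} x y = prod m (λ j → δ (x j) (y j))

∑ₜ-select : (ks : Fin m → ℕ) (f : Tuple m ks → ℕ) → (∀ x y → (∀ j → x j ≡ y j) → f x ≡ f y) →
            (x : Tuple m ks) → ∑ₜ m ks (λ t → f t * δₜ x t) ≡ f x
∑ₜ-select {zero} ks f f-resp x = trans (+-identityʳ _) (trans (*-identityʳ _) (f-resp (λ ()) x (λ ())))
∑ₜ-select {suc m} ks f f-resp x = begin
  ∑ₜ (suc m) ks (λ t → f t * δₜ x t)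
    ≡⟨ ∑ₜ-suc ks (λ t → f t * δₜ x t) ⟩
  ∑ (ks zero) (λ i → ∑ₜ m ks′ (λ t → f (consT i t) * (δ (x zero) i * δₜ x′ t)))
    ≡⟨ ∑-cong (λ i → trans (∑ₜ-cong (λ t → regroup (f (consT i t)) (δ (x zero) i) (δₜ x′ t)))
                           (sum-map-*ʳ (λ t → f (consT i t) * δₜ x′ t) (δ (x zero) i) (tuples m ks′))) ⟩
  ∑ (ks zero) (λ i → ∑ₜ m ks′ (λ t → f (consT i t) * δₜ x′ t) * δ (x zero) i)
    ≡⟨ ∑-cong (λ i → cong (_* δ (x zero) i) (∑ₜ-select ks′ (f ∘ consT i) (f∘consT-resp i) x′)) ⟩
  ∑ (ks zero) (λ i → f (consT i x′) * δ (x zero) i)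
    ≡⟨ ∑-select (λ i → f (consT i x′)) (x zero) ⟩
  f (consT (x zero) x′)
    ≡⟨ f-resp (consT (x zero) x′) x (λ { zero → refl ; (suc j) → refl }) ⟩
  f x ∎
  where
  ks′ = ks ∘ suc
  x′ : Tuple m ks′
  x′ = x ∘ suc
  regroup : ∀ p q r → p * (q * r) ≡ p * r * q
  regroup p q r = trans (cong (p *_) (*-comm q r)) (sym (*-assoc p r q))
  f∘consT-resp : ∀ i (y z : Tuple m ks′) → (∀ j → y j ≡ z j) → f (consT i y) ≡ f (consT i z)
  f∘consT-resp i y z y≗z = f-resp (consT i y) (consT i z) λ { zero → refl ; (suc j) → y≗z j }

prod-cong : {ks ls : Fin m → ℕ} → (∀ j → ks j ≡ ls j) → prod m ks ≡ prod m ls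
prod-cong {zero}  ks≗ls = refl
prod-cong {suc m} ks≗ls = cong₂ _*_ (ks≗ls zero) (prod-cong (ks≗ls ∘ suc))

prod-* : (f g : Fin m → ℕ) → prod m (λ j → f j * g j) ≡ prod m f * prod m g
prod-* {zero}  f g = refl
prod-* {suc m} f g = trans (cong (f zero * g zero *_) (prod-* (f ∘ suc) (g ∘ suc)))
                           ([m*n]*[o*p]≡[m*o]*[n*p] (f zero) (g zero) _ _)

toTuple : (m : ℕ) (ks : Fin m → ℕ) → Fin (prod m ks) → Tuple m ks
toTuple zero    ks r ()
toTuple (suc m) ks r = consT {ks = ks} (quotient {ks zero} (prod m (ks ∘ suc)) r)
                                      (toTuple m (ks ∘ suc) (remainder {ks zero} (prod m (ks ∘ suc)) r))

fromTuple : (m : ℕ) (ks : Fin m → ℕ) → Tuple m ks → Fin (prod m ks)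
fromTuple zero    ks t = zero
fromTuple (suc m) ks t = combine (t zero) (fromTuple m (ks ∘ suc) (t ∘ suc))

fromTuple-toTuple : (ks : Fin m → ℕ) (r : Fin (prod m ks)) → fromTuple m ks (toTuple m ks r) ≡ r
fromTuple-toTuple {zero}  ks zero = refl
fromTuple-toTuple {suc m} ks r =
  trans (cong (combine (quotient {ks zero} k r)) (fromTuple-toTuple (ks ∘ suc) (remainder {ks zero} k r)))
        (combine-remQuot {ks zero} k r)
  where k = prod m (ks ∘ suc)

toTuple-fromTuple : (ks : Fin m → ℕ) (t : Tuple m ks) (j : Fin m) → toTuple m ks (fromTuple m ks t) j ≡ t j
toTuple-fromTuple {suc m} ks t j
  with remQuot-combine {ks zero} {prod m (ks ∘ suc)} (t zero) (fromTuple m (ks ∘ suc) (t ∘ suc))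
toTuple-fromTuple {suc m} ks t zero    | eq = cong proj₁ eq
toTuple-fromTuple {suc m} ks t (suc j) | eq =
  trans (cong (λ p → toTuple m (ks ∘ suc) (proj₂ p) j) eq) (toTuple-fromTuple (ks ∘ suc) (t ∘ suc) j)

fromTuple-cong : (ks : Fin m → ℕ) {s t : Tuple m ks} → (∀ j → s j ≡ t j) → fromTuple m ks s ≡ fromTuple m ks t
fromTuple-cong {zero}  ks s≗t = refl
fromTuple-cong {suc m} ks s≗t = cong₂ combine (s≗t zero) (fromTuple-cong (ks ∘ suc) (s≗t ∘ suc))

toℕ-fromTuple-cong : (ks ls : Fin m → ℕ) {s : Tuple m ks} {t : Tuple m ls} →
                     (∀ j → ks j ≡ ls j) → (∀ j → toℕ (s j) ≡ toℕ (t j)) →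
                     toℕ (fromTuple m ks s) ≡ toℕ (fromTuple m ls t)
toℕ-fromTuple-cong {zero}  ks ls ks≗ls s≈t = refl
toℕ-fromTuple-cong {suc m} ks ls {s} {t} ks≗ls s≈t = begin
  toℕ (combine (s zero) (fromTuple m (ks ∘ suc) (s ∘ suc)))
    ≡⟨ toℕ-combine (s zero) _ ⟩
  prod m (ks ∘ suc) * toℕ (s zero) + toℕ (fromTuple m (ks ∘ suc) (s ∘ suc))
    ≡⟨ cong₂ _+_ (cong₂ _*_ (prod-cong (ks≗ls ∘ suc)) (s≈t zero))
                 (toℕ-fromTuple-cong (ks ∘ suc) (ls ∘ suc) (ks≗ls ∘ suc) (s≈t ∘ suc)) ⟩
  prod m (ls ∘ suc) * toℕ (t zero) + toℕ (fromTuple m (ls ∘ suc) (t ∘ suc))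
    ≡⟨ toℕ-combine (t zero) _ ⟨
  toℕ (combine (t zero) (fromTuple m (ls ∘ suc) (t ∘ suc))) ∎

δₜ≡δ-fromTuple : (ks : Fin m → ℕ) (s t : Tuple m ks) → δₜ s t ≡ δ (fromTuple m ks s) (fromTuple m ks t)
δₜ≡δ-fromTuple {zero}  ks s t = refl
δₜ≡δ-fromTuple {suc m} ks s t =
  trans (cong (δ (s zero) (t zero) *_) (δₜ≡δ-fromTuple (ks ∘ suc) (s ∘ suc) (t ∘ suc)))
        (sym (δ-combine (s zero) (t zero) _ _))

kron-entry : (ks ls : Fin m → ℕ) (M : (j : Fin m) → Mat (ks j) (ls j)) (r : Fin (prod m ks)) (c : Fin (prod m ls)) →
             kron m ks ls M r c ≡ prod m (λ j → M j (toTuple m ks r j) (toTuple m ls c j))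
kron-entry {zero}  ks ls M r c = refl
kron-entry {suc m} ks ls M r c = cong (M zero _ _ *_) (kron-entry (ks ∘ suc) (ls ∘ suc) (M ∘ suc) _ _)

permMat : Permutation b a → Mat a b
permMat π r c = δ r (π ⟨$⟩ʳ c)

δ-⟨$⟩ʳ : (π : Permutation b a) (r : Fin a) (c : Fin b) → δ r (π ⟨$⟩ʳ c) ≡ δ (π ⟨$⟩ˡ r) c
δ-⟨$⟩ʳ π r c = δ-cong-⇔ (mk⇔
  (λ r≡πc → trans (cong (π ⟨$⟩ˡ_) r≡πc) (inverseˡ π))
  (λ π⁻¹r≡c → trans (sym (inverseʳ π)) (cong (π ⟨$⟩ʳ_) π⁻¹r≡c)))

permMat-transpose : (π : Permutation b a) → transpose (permMat π) ≐ permMat (flip π)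
permMat-transpose π c r = trans (δ-⟨$⟩ʳ π r c) (δ-sym (π ⟨$⟩ˡ r) c)

permMat·transpose : (π : Permutation b a) → permMat π · transpose (permMat π) ≐ idMat a
permMat·transpose π r r′ = begin
  ∑ _ (λ c → δ r (π ⟨$⟩ʳ c) * δ r′ (π ⟨$⟩ʳ c))
    ≡⟨ ∑-cong (λ c → cong (δ r (π ⟨$⟩ʳ c) *_) (δ-⟨$⟩ʳ π r′ c)) ⟩
  ∑ _ (λ c → δ r (π ⟨$⟩ʳ c) * δ (π ⟨$⟩ˡ r′) c)
    ≡⟨ ∑-select (λ c → δ r (π ⟨$⟩ʳ c)) (π ⟨$⟩ˡ r′) ⟩
  δ r (π ⟨$⟩ʳ (π ⟨$⟩ˡ r′))
    ≡⟨ cong (δ r) (inverseʳ π) ⟩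
  δ r r′ ∎

transpose·permMat : (π : Permutation b a) → transpose (permMat π) · permMat π ≐ idMat b
transpose·permMat π c c′ = begin
  ∑ _ (λ r → δ r (π ⟨$⟩ʳ c) * δ r (π ⟨$⟩ʳ c′))
    ≡⟨ ∑-cong (λ r → trans (*-comm (δ r (π ⟨$⟩ʳ c)) _) (cong (δ r (π ⟨$⟩ʳ c′) *_) (δ-sym r (π ⟨$⟩ʳ c)))) ⟩
  ∑ _ (λ r → δ r (π ⟨$⟩ʳ c′) * δ (π ⟨$⟩ʳ c) r)
    ≡⟨ ∑-select (λ r → δ r (π ⟨$⟩ʳ c′)) (π ⟨$⟩ʳ c) ⟩
  δ (π ⟨$⟩ʳ c) (π ⟨$⟩ʳ c′)
    ≡⟨ δ-⟨$⟩ʳ π (π ⟨$⟩ʳ c) c′ ⟩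
  δ (π ⟨$⟩ˡ (π ⟨$⟩ʳ c)) c′
    ≡⟨ cong (λ x → δ x c′) (inverseˡ π) ⟩
  δ c c′ ∎

cast-dcong : {ks : Fin m → ℕ} (t : Tuple m ks) {i j : Fin m} .(p : ks i ≡ ks j) → i ≡ j → cast p (t i) ≡ t j
cast-dcong t {i} p refl = cast-is-id p (t i)

shuffleIndex : (m : ℕ) (ks : Fin m → ℕ) (ρ : Permutation′ m) →
               Permutation (prod m ks) (prod m (λ j → ks (ρ ⟨$⟩ˡ j)))
shuffleIndex m ks ρ = permutation to from to∘from from∘to
  where
  ks′ : Fin m → ℕ
  ks′ j = ks (ρ ⟨$⟩ˡ j)
  to : Fin (prod m ks) → Fin (prod m ks′)
  to c = fromTuple m ks′ (λ j → toTuple m ks c (ρ ⟨$⟩ˡ j))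
  -- The digit at ρ k has radix ks (ρ⁻¹ (ρ k)), which is only propositionally ks k.
  from : Fin (prod m ks′) → Fin (prod m ks)
  from r = fromTuple m ks (λ k → cast (cong ks (inverseˡ ρ)) (toTuple m ks′ r (ρ ⟨$⟩ʳ k)))
  to∘from : ∀ r → to (from r) ≡ r
  to∘from r = trans
    (fromTuple-cong ks′ (λ j → trans (toTuple-fromTuple ks _ (ρ ⟨$⟩ˡ j))
                                     (cast-dcong (toTuple m ks′ r) (cong ks (inverseˡ ρ)) (inverseʳ ρ))))
    (fromTuple-toTuple ks′ r)
  from∘to : ∀ c → from (to c) ≡ c
  from∘to c = trans
    (fromTuple-cong ks (λ k → trans (cong (cast (cong ks (inverseˡ ρ))) (toTuple-fromTuple ks′ _ (ρ ⟨$⟩ʳ k)))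
                                    (cast-dcong (toTuple m ks c) (cong ks (inverseˡ ρ)) (inverseˡ ρ))))
    (fromTuple-toTuple ks c)

shuffle≐permMat : (m : ℕ) (ks : Fin m → ℕ) (ρ : Permutation′ m) → shuffle m ks ρ ≐ permMat (shuffleIndex m ks ρ)
shuffle≐permMat m ks ρ r c = begin
  ∑ₜ m ks (λ t → kron m ks′ ks (λ j → E (ks′ j) (ks j) (t (ρ ⟨$⟩ˡ j)) (t j)) r c)
    ≡⟨ ∑ₜ-cong kron-entry-δ ⟩
  ∑ₜ m ks (λ t → prod m (λ j → δ (r̂ j) (t (ρ ⟨$⟩ˡ j))) * δₜ ĉ t)
    ≡⟨ ∑ₜ-select ks (λ t → prod m (λ j → δ (r̂ j) (t (ρ ⟨$⟩ˡ j))))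
                    (λ s t s≗t → prod-cong (λ j → cong (δ (r̂ j)) (s≗t (ρ ⟨$⟩ˡ j)))) ĉ ⟩
  δₜ r̂ (λ j → ĉ (ρ ⟨$⟩ˡ j))
    ≡⟨ δₜ≡δ-fromTuple ks′ r̂ (λ j → ĉ (ρ ⟨$⟩ˡ j)) ⟩
  δ (fromTuple m ks′ r̂) (shuffleIndex m ks ρ ⟨$⟩ʳ c)
    ≡⟨ cong (λ x → δ x (shuffleIndex m ks ρ ⟨$⟩ʳ c)) (fromTuple-toTuple ks′ r) ⟩
  δ r (shuffleIndex m ks ρ ⟨$⟩ʳ c) ∎
  where
  ks′ : Fin m → ℕ
  ks′ j = ks (ρ ⟨$⟩ˡ j)
  r̂ = toTuple m ks′ r
  ĉ = toTuple m ks c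
  kron-entry-δ : ∀ t → kron m ks′ ks (λ j → E (ks′ j) (ks j) (t (ρ ⟨$⟩ˡ j)) (t j)) r c
                       ≡ prod m (λ j → δ (r̂ j) (t (ρ ⟨$⟩ˡ j))) * δₜ ĉ t
  kron-entry-δ t = begin
    kron m ks′ ks (λ j → E (ks′ j) (ks j) (t (ρ ⟨$⟩ˡ j)) (t j)) r c
      ≡⟨ kron-entry ks′ ks _ r c ⟩
    prod m (λ j → E (ks′ j) (ks j) (t (ρ ⟨$⟩ˡ j)) (t j) (r̂ j) (ĉ j))
      ≡⟨ prod-cong (λ j → E≡δ*δ (t (ρ ⟨$⟩ˡ j)) (t j) (r̂ j) (ĉ j)) ⟩
    prod m (λ j → δ (r̂ j) (t (ρ ⟨$⟩ˡ j)) * δ (ĉ j) (t j))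
      ≡⟨ prod-* (λ j → δ (r̂ j) (t (ρ ⟨$⟩ˡ j))) (λ j → δ (ĉ j) (t j)) ⟩
    prod m (λ j → δ (r̂ j) (t (ρ ⟨$⟩ˡ j))) * δₜ ĉ t ∎

toℕ-shuffleIndex-flip : (m : ℕ) (ks : Fin m → ℕ) (σ : Permutation′ m) (r : Fin (prod m (λ j → ks (σ ⟨$⟩ˡ j)))) →
                        toℕ (shuffleIndex m ks σ ⟨$⟩ˡ r)
                          ≡ toℕ (shuffleIndex m (λ j → ks (σ ⟨$⟩ˡ j)) (flip σ) ⟨$⟩ʳ r)
toℕ-shuffleIndex-flip m ks σ r =
  toℕ-fromTuple-cong ks (λ k → ks (σ ⟨$⟩ˡ (σ ⟨$⟩ʳ k))) (λ k → cong ks (sym (inverseˡ σ))) (λ k → toℕ-cast _ _)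

shuffle-transpose : (m : ℕ) (ks : Fin m → ℕ) (σ : Permutation′ m) →
                    transpose (shuffle m ks σ) ≋ shuffle m (λ j → ks (σ ⟨$⟩ˡ j)) (flip σ)
shuffle-transpose m ks σ = dims , refl , entry
  where
  ks′ : Fin m → ℕ
  ks′ j = ks (σ ⟨$⟩ˡ j)
  π = shuffleIndex m ks σ
  π′ = shuffleIndex m ks′ (flip σ)
  dims : prod m ks ≡ prod m (λ j → ks′ (flip σ ⟨$⟩ˡ j))
  dims = prod-cong {m} (λ k → cong ks (sym (inverseˡ σ)))
  entry : ∀ c r → shuffle m ks σ r c ≡ shuffle m ks′ (flip σ) (cast dims c) (cast refl r)
  entry c r = begin
    shuffle m ks σ r c                       ≡⟨ shuffle≐permMat m ks σ r c ⟩
    δ r (π ⟨$⟩ʳ c)                           ≡⟨ permMat-transpose π c r ⟩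
    δ c (π ⟨$⟩ˡ r)                           ≡⟨ δ-toℕ (sym (toℕ-cast dims c)) π⁻¹r≈π′r ⟩
    δ (cast dims c) (π′ ⟨$⟩ʳ cast refl r)    ≡⟨ shuffle≐permMat m ks′ (flip σ) (cast dims c) (cast refl r) ⟨
    shuffle m ks′ (flip σ) (cast dims c) (cast refl r) ∎
    where
    π⁻¹r≈π′r : toℕ (π ⟨$⟩ˡ r) ≡ toℕ (π′ ⟨$⟩ʳ cast refl r)
    π⁻¹r≈π′r = trans (toℕ-shuffleIndex-flip m ks σ r) (cong (λ x → toℕ (π′ ⟨$⟩ʳ x)) (sym (cast-is-id refl r)))

·-cong : {A A′ : Mat a m} {B B′ : Mat m b} → A ≐ A′ → B ≐ B′ → A · B ≐ A′ · B′
·-cong A≐A′ B≐B′ i k = ∑-cong (λ j → cong₂ _*_ (A≐A′ i j) (B≐B′ j k))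

≐-trans : {A B C : Mat a b} → A ≐ B → B ≐ C → A ≐ C
≐-trans A≐B B≐C i j = trans (A≐B i j) (B≐C i j)

corollary4p2 : (m : ℕ) → 2 ≤ m → (ns : Fin m → ℕ) → (∀ j → 2 ≤ ns j) →
    (σ : Permutation′ m) →
    (shuffle m ns σ · transpose (shuffle m ns σ) ≐ idMat _)
    × (transpose (shuffle m ns σ) · shuffle m ns σ ≐ idMat _)
    × (transpose (shuffle m ns σ) ≋ shuffle m (λ j → ns (σ ⟨$⟩ˡ j)) (flip σ))
corollary4p2 m _ ns _ σ =
    ≐-trans (·-cong S≐P Sᵀ≐Pᵀ) (permMat·transpose π)
  , ≐-trans (·-cong Sᵀ≐Pᵀ S≐P) (transpose·permMat π)
  , shuffle-transpose m ns σ
  where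
  π = shuffleIndex m ns σ
  S≐P : shuffle m ns σ ≐ permMat π
  S≐P = shuffle≐permMat m ns σ
  Sᵀ≐Pᵀ : transpose (shuffle m ns σ) ≐ transpose (permMat π)
  Sᵀ≐Pᵀ c r = S≐P r c
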